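{- Let $t\ge 3$ be an odd integer and $n=(t+2)m$ with $m$ a positive integer, $m\ne 1$. Then $\chi(C_n(2,t))=3$.
   Context: For integers $n$ and $s_1,\ldots,s_k$, the circulant graph $C_n(s_1,\ldots,s_k)$ has vertex set $\{0,1,\ldots,n-1\}$, and each vertex $i$ is adjacent to $i+s_j \pmod n$ (and hence to $i-s_j\pmod n$) for every $j\in\{1,\ldots,k\}$. $\chi$ denotes the (proper) chromatic number. -}

module Defs where

open import Data.Nat using (ℕ; suc; _+_; _<_; NonZero)
open import Data.Nat.DivMod using (_%_)
open import Data.Fin using (Fin; toℕ)
open import Data.List using (List)
open import Data.List.Membership.Propositional using (_∈_)
open import Data.Product using (∃-syntax; _×_; Σ)
open import Data.Sum using (_⊎_)
open import Relation.Binary.PropositionalEquality using (_≡_; _≢_)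
open import Relation.Nullary using (¬_)

CirculantAdj : (n : ℕ) → .{{_ : NonZero n}} → List ℕ → Fin n → Fin n → Set
CirculantAdj n S i j =
  ∃[ s ] (s ∈ S × (toℕ j ≡ (toℕ i + s) % n ⊎ toℕ i ≡ (toℕ j + s) % n))

ProperColouring : {n : ℕ} → (Fin n → Fin n → Set) → (k : ℕ) → (Fin n → Fin k) → Set
ProperColouring adj k c = ∀ i j → adj i j → c i ≢ c j

Colourable : {n : ℕ} → (Fin n → Fin n → Set) → ℕ → Set
Colourable adj k = Σ (_ → Fin k) (ProperColouring adj k)

ChromaticNumber : {n : ℕ} → (Fin n → Fin n → Set) → ℕ → Set
ChromaticNumber adj k = Colourable adj k × (∀ j → j < k → ¬ Colourable adj j)

-- The graph C_n(2, t) maps homomorphically onto C_{t+2}(2, t) by reduction modulo t + 2,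
-- and there the step t is the step −2, so C_{t+2}(2, t) is the cycle r, r + 2, r + 4, …,
-- which is 3-colourable. Conversely, a 2-colouring would alternate along steps of 2, hence
-- be 4-periodic, and alternate along steps of t; but 2t = 4k + 2 for t = 2k + 1, so the
-- vertices 0 and 2 would get the colour of 2t, although they are adjacent.
module Submission where

open import Defs
open import Data.Nat using (ℕ; suc; _+_; _*_; _≤_; NonZero)
open import Data.Product using (∃-syntax)
open import Data.List using (List; _∷_; [])
open import Relation.Binary.PropositionalEquality using (_≡_; _≢_)

open import Data.Bool using (Bool; true; false; not)
open import Data.Fin using (Fin; toℕ; fromℕ<; inject≤; zero; suc)
open import Data.Fin.Properties using (toℕ<n; toℕ-fromℕ<; inject≤-injective)
open import Data.List.Membership.Propositional using (_∈_)
open import Data.List.Relation.Unary.Any using (here; there)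
open import Data.Nat using (zero; _<_; _∸_; s≤s; _≤?_)
open import Data.Nat.DivMod
open import Data.Nat.Divisibility using (_∣_; divides)
open import Data.Nat.Properties
open import Data.Nat.Tactic.RingSolver using (solve-∀)
open import Data.Product using (_,_)
open import Data.Sum using (_⊎_; inj₁; inj₂)
open import Function using (_∘_)
open import Relation.Binary.PropositionalEquality using (refl; sym; trans; cong; module ≡-Reasoning)
open import Relation.Nullary using (¬_; yes; no; contradiction)

private
  variable
    n m j k : ℕ

Colourable-mono : {adj : Fin n → Fin n → Set} → j ≤ k → Colourable adj j → Colourable adj k
Colourable-mono j≤k (c , proper) =
  (λ i → inject≤ (c i) j≤k) , λ i i′ e eq → proper i i′ e (inject≤-injective j≤k j≤k _ _ eq)

Colourable-via-homomorphism : {adj : Fin n → Fin n → Set} {adj′ : Fin m → Fin m → Set}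
  (f : Fin n → Fin m) → (∀ i i′ → adj i i′ → adj′ (f i) (f i′)) →
  Colourable adj′ k → Colourable adj k
Colourable-via-homomorphism f hom (c , proper) = c ∘ f , λ i i′ e → proper (f i) (f i′) (hom i i′ e)

[m+n]%d≡[m%d+n]%d : ∀ m n d .{{_ : NonZero d}} → (m + n) % d ≡ (m % d + n) % d
[m+n]%d≡[m%d+n]%d m n d = begin
  (m + n) % d                ≡⟨ %-distribˡ-+ m n d ⟩
  (m % d + n % d) % d        ≡⟨ cong (λ x → (x + n % d) % d) (m%n%n≡m%n m d) ⟨
  (m % d % d + n % d) % d    ≡⟨ %-distribˡ-+ (m % d) n d ⟨
  (m % d + n) % d            ∎
  where open ≡-Reasoning

residue : (d : ℕ) .{{_ : NonZero d}} → ℕ → Fin d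
residue d x = fromℕ< (m%n<n x d)

toℕ-residue : ∀ d .{{_ : NonZero d}} x → toℕ (residue d x) ≡ x % d
toℕ-residue d x = toℕ-fromℕ< (m%n<n x d)

residue-step : ∀ d .{{_ : NonZero d}} .{{_ : NonZero n}} → d ∣ n → ∀ x y s →
  y ≡ (x + s) % n → toℕ (residue d y) ≡ (toℕ (residue d x) + s) % d
residue-step {n} d d∣n x y s y≡[x+s]%n = begin
  toℕ (residue d y)          ≡⟨ toℕ-residue d y ⟩
  y % d                      ≡⟨ cong (_% d) y≡[x+s]%n ⟩
  (x + s) % n % d            ≡⟨ m∣n⇒o%n%m≡o%m d n (x + s) d∣n ⟩
  (x + s) % d                ≡⟨ [m+n]%d≡[m%d+n]%d x s d ⟩
  (x % d + s) % d            ≡⟨ cong (λ z → (z + s) % d) (toℕ-residue d x) ⟨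
  (toℕ (residue d x) + s) % d ∎
  where open ≡-Reasoning

module _ {S : List ℕ} where

  CirculantAdj-residue : ∀ .{{_ : NonZero n}} {s} → s ∈ S → ∀ x →
    CirculantAdj n S (residue n x) (residue n (x + s))
  CirculantAdj-residue {n} {s} s∈S x = s , s∈S , inj₁ (begin
    toℕ (residue n (x + s))        ≡⟨ toℕ-residue n (x + s) ⟩
    (x + s) % n                    ≡⟨ [m+n]%d≡[m%d+n]%d x s n ⟩
    (x % n + s) % n                ≡⟨ cong (λ y → (y + s) % n) (toℕ-residue n x) ⟨
    (toℕ (residue n x) + s) % n    ∎)
    where open ≡-Reasoning

  CirculantAdj-reduce : ∀ d .{{_ : NonZero d}} .{{_ : NonZero n}} → d ∣ n → ∀ i i′ →
    CirculantAdj n S i i′ → CirculantAdj d S (residue d (toℕ i)) (residue d (toℕ i′))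
  CirculantAdj-reduce d d∣n i i′ (s , s∈S , inj₁ eq) = s , s∈S , inj₁ (residue-step d d∣n (toℕ i) (toℕ i′) s eq)
  CirculantAdj-reduce d d∣n i i′ (s , s∈S , inj₂ eq) = s , s∈S , inj₂ (residue-step d d∣n (toℕ i′) (toℕ i) s eq)

Fin2-≢-≢⇒≡ : (a b c : Fin 2) → a ≢ b → b ≢ c → a ≡ c
Fin2-≢-≢⇒≡ zero       zero       _          a≢b _   = contradiction refl a≢b
Fin2-≢-≢⇒≡ zero       (suc zero) zero       _   _   = refl
Fin2-≢-≢⇒≡ zero       (suc zero) (suc zero) _   b≢c = contradiction refl b≢c
Fin2-≢-≢⇒≡ (suc zero) zero       zero       _   b≢c = contradiction refl b≢c
Fin2-≢-≢⇒≡ (suc zero) zero       (suc zero) _   _   = refl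
Fin2-≢-≢⇒≡ (suc zero) (suc zero) _          a≢b _   = contradiction refl a≢b

module _ (F : ℕ → Fin 2) (alternates : ∀ x → F x ≢ F (2 + x)) where

  alternating-4-periodic : ∀ q x → F (q * 4 + x) ≡ F x
  alternating-4-periodic zero    x = refl
  alternating-4-periodic (suc q) x =
    trans (Fin2-≢-≢⇒≡ _ _ _ (alternates (2 + y) ∘ sym) (alternates y ∘ sym)) (alternating-4-periodic q x)
    where y = q * 4 + x

  alternating-¬alternates-odd : ∀ {t} k → t ≡ 2 * k + 1 → ¬ (∀ x → F x ≢ F (x + t))
  alternating-¬alternates-odd {t} k t≡2k+1 alternates-t = alternates 0 (begin
    F 0                           ≡⟨ Fin2-≢-≢⇒≡ _ _ _ (alternates-t 0) (alternates-t t) ⟩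
    F (t + t)                     ≡⟨ cong (λ u → F (u + u)) t≡2k+1 ⟩
    F ((2 * k + 1) + (2 * k + 1)) ≡⟨ cong F (double-odd k) ⟩
    F (k * 4 + 2)                 ≡⟨ alternating-4-periodic k 2 ⟩
    F 2                           ∎)
    where open ≡-Reasoning
          double-odd : ∀ k → (2 * k + 1) + (2 * k + 1) ≡ k * 4 + 2
          double-odd = solve-∀

¬Colourable-2-circulant-2-odd : ∀ .{{_ : NonZero n}} {S t} k → 2 ∈ S → t ∈ S → t ≡ 2 * k + 1 →
  ¬ Colourable (CirculantAdj n S) 2
¬Colourable-2-circulant-2-odd {n} {t = t} k 2∈S t∈S t≡2k+1 (c , proper) =
  alternating-¬alternates-odd F alternates k t≡2k+1 (λ x → proper _ _ (CirculantAdj-residue t∈S x))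
  where
  F : ℕ → Fin 2
  F x = c (residue n x)
  alternates : ∀ x → F x ≢ F (2 + x)
  alternates x rewrite +-comm 2 x = proper _ _ (CirculantAdj-residue 2∈S x)

pairParity : ℕ → Bool
pairParity zero          = false
pairParity (suc zero)    = false
pairParity (suc (suc r)) = not (pairParity r)

bit : Bool → Fin 3
bit false = zero
bit true  = suc zero

bit≢2 : ∀ b → bit b ≢ suc (suc zero)
bit≢2 false ()
bit≢2 true  ()

bit≢bit-not : ∀ b → bit b ≢ bit (not b)
bit≢bit-not false ()
bit≢bit-not true  ()

-- Along 0, 2, 4, … the residues below p − 2 get the colours 0, 1, 0, 1, …; colour 2 is
-- reserved for p − 2 and p − 1, whose successors 0 and 1 have colour 0.
cycleColour : ℕ → ℕ → Fin 3
cycleColour p r with p ≤? 2 + r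
... | yes _ = suc (suc zero)
... | no  _ = bit (pairParity r)

cycleColour-initial : ∀ {p r} → 4 ≤ p → r ≤ 1 → cycleColour p r ≡ bit (pairParity r)
cycleColour-initial {p} {r} 4≤p r≤1 with p ≤? 2 + r
... | yes p≤2+r = contradiction (≤-trans 4≤p (≤-trans p≤2+r (+-monoʳ-≤ 2 r≤1))) (<⇒≱ ≤-refl)
... | no  _     = refl

bit≢cycleColour-2+ : ∀ p a → bit (pairParity a) ≢ cycleColour p (2 + a)
bit≢cycleColour-2+ p a with p ≤? 2 + (2 + a)
... | yes _ = bit≢2 (pairParity a)
... | no  _ = bit≢bit-not (pairParity a)

cycleColour-step : ∀ {p a} .{{_ : NonZero p}} → 4 ≤ p → a < p →
  cycleColour p a ≢ cycleColour p ((a + 2) % p)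
cycleColour-step {p} {a} 4≤p a<p rewrite +-comm a 2 with p ≤? 2 + a
... | yes p≤2+a = λ e → bit≢2 _ (trans (sym (cycleColour-initial 4≤p wrap≤1)) (sym e))
  where
  open ≤-Reasoning
  wrap≤1 : (2 + a) % p ≤ 1
  wrap≤1 = begin
    (2 + a) % p      ≡⟨ m≤n⇒[n∸m]%m≡n%m p≤2+a ⟨
    (2 + a ∸ p) % p  ≤⟨ m%n≤m (2 + a ∸ p) p ⟩
    2 + a ∸ p        ≤⟨ m≤n+o⇒m∸n≤o (2 + a) p (≤-trans (s≤s a<p) (≤-reflexive (+-comm 1 p))) ⟩
    1                ∎
... | no p≰2+a rewrite m<n⇒m%n≡m (≰⇒> p≰2+a) = bit≢cycleColour-2+ p a

module _ (t : ℕ) where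

  private
    p : ℕ
    p = 2 + t

  step-t-reverses-step-2 : ∀ a → a < p → a ≡ ((a + t) % p + 2) % p
  step-t-reverses-step-2 a a<p = sym (begin
    ((a + t) % p + 2) % p  ≡⟨ [m+n]%d≡[m%d+n]%d (a + t) 2 p ⟨
    (a + t + 2) % p        ≡⟨ cong (_% p) (trans (+-assoc a t 2) (cong (a +_) (+-comm t 2))) ⟩
    (a + p) % p            ≡⟨ [m+n]%n≡m%n a p ⟩
    a % p                  ≡⟨ m<n⇒m%n≡m a<p ⟩
    a                      ∎)
    where open ≡-Reasoning

  CirculantAdj-[2,t]⇒step-2 : ∀ {i i′} → CirculantAdj p (2 ∷ t ∷ []) i i′ →
    toℕ i′ ≡ (toℕ i + 2) % p ⊎ toℕ i ≡ (toℕ i′ + 2) % p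
  CirculantAdj-[2,t]⇒step-2 (_ , here refl ,               inj₁ eq) = inj₁ eq
  CirculantAdj-[2,t]⇒step-2 (_ , here refl ,               inj₂ eq) = inj₂ eq
  CirculantAdj-[2,t]⇒step-2 {i} {i′} (_ , there (here refl) , inj₁ eq) =
    inj₂ (trans (step-t-reverses-step-2 (toℕ i) (toℕ<n i)) (cong (λ b → (b + 2) % p) (sym eq)))
  CirculantAdj-[2,t]⇒step-2 {i} {i′} (_ , there (here refl) , inj₂ eq) =
    inj₁ (trans (step-t-reverses-step-2 (toℕ i′) (toℕ<n i′)) (cong (λ b → (b + 2) % p) (sym eq)))

  Colourable-3-[2,t] : 2 ≤ t → Colourable (CirculantAdj p (2 ∷ t ∷ [])) 3
  Colourable-3-[2,t] 2≤t = colour , proper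
    where
    colour : Fin p → Fin 3
    colour i = cycleColour p (toℕ i)
    proper : ProperColouring (CirculantAdj p (2 ∷ t ∷ [])) 3 colour
    proper i i′ adj with CirculantAdj-[2,t]⇒step-2 adj
    ... | inj₁ eq = λ e → cycleColour-step (+-monoʳ-≤ 2 2≤t) (toℕ<n i) (trans e (cong (cycleColour p) eq))
    ... | inj₂ eq = λ e → cycleColour-step (+-monoʳ-≤ 2 2≤t) (toℕ<n i′) (trans (sym e) (cong (cycleColour p) eq))

proposition10 : (t m : ℕ) → 3 ≤ t → (∃[ k ] t ≡ 2 * k + 1) → 1 ≤ m → m ≢ 1 →
    (n : ℕ) → .{{_ : NonZero n}} → n ≡ (t + 2) * m →
    ChromaticNumber (CirculantAdj n (2 ∷ t ∷ [])) 3
proposition10 t m 3≤t (k , t≡2k+1) _ _ n n≡[t+2]m =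
  Colourable-via-homomorphism (residue (2 + t) ∘ toℕ) (CirculantAdj-reduce (2 + t) [2+t]∣n)
    (Colourable-3-[2,t] t (≤-trans (n≤1+n 2) 3≤t)) ,
  λ j j<3 → ¬Colourable-2-circulant-2-odd k (here refl) (there (here refl)) t≡2k+1 ∘ Colourable-mono (≤-pred j<3)
  where
  [2+t]∣n : 2 + t ∣ n
  [2+t]∣n = divides m (trans n≡[t+2]m (trans (*-comm (t + 2) m) (cong (m *_) (+-comm t 2))))
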